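{- For any positive integers $i$ and $j$, if an $(i,j)$ phylogeny graph $G$ is triangle-free, then $G$ is a forest with maximum degree at most $j+1$.
   Context: All digraphs are finite and simple. An $(i,j)$ digraph is an acyclic digraph in which every vertex has indegree at most $i$ and outdegree at most $j$. For an acyclic digraph $D$, the phylogeny graph $P(D)$ has vertex set $V(D)$, with $u\ne v$ adjacent iff $(u,v)\in A(D)$, or $(v,u)\in A(D)$, or $u$ and $v$ have a common out-neighbor in $D$. A graph $G$ is an $(i,j)$ phylogeny graph if $G\cong P(D)$ for some $(i,j)$ digraph $D$. -}

module Defs where

open import Data.Nat using (ℕ; zero; suc; _≤_)
open import Data.Bool using (Bool; true; false)
open import Data.Fin using (Fin; zero; suc)
open import Data.List using (List; length; filterᵇ; allFin)
open import Data.Vec using (Vec; lookup)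
open import Data.Product using (Σ; ∃; _×_; _,_)
open import Data.Sum using (_⊎_)
open import Data.Empty using (⊥)
open import Relation.Nullary using (¬_)
open import Relation.Binary.PropositionalEquality using (_≡_; _≢_)
open import Function.Bundles using (_↔_; Inverse)
open import Function.Definitions using (Injective)

record Digraph (n : ℕ) : Set where
  field
    arc     : Fin n → Fin n → Bool
    loopless : ∀ v → arc v v ≡ false
open Digraph public

data Reach⁺ {n : ℕ} (D : Digraph n) : Fin n → Fin n → Set where
  step : ∀ {u v} → arc D u v ≡ true → Reach⁺ D u v
  _∷_  : ∀ {u v w} → arc D u v ≡ true → Reach⁺ D v w → Reach⁺ D u w

Acyclic : ∀ {n} → Digraph n → Set
Acyclic D = ∀ v → ¬ Reach⁺ D v v

outdeg : ∀ {n} → Digraph n → Fin n → ℕ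
outdeg {n} D v = length (filterᵇ (λ u → arc D v u) (allFin n))

indeg : ∀ {n} → Digraph n → Fin n → ℕ
indeg {n} D v = length (filterᵇ (λ u → arc D u v) (allFin n))

IJDigraph : ℕ → ℕ → ∀ {n} → Digraph n → Set
IJDigraph i j D = Acyclic D × (∀ v → indeg D v ≤ i) × (∀ v → outdeg D v ≤ j)

PAdj : ∀ {n} → Digraph n → Fin n → Fin n → Set
PAdj D u v = u ≢ v × (arc D u v ≡ true ⊎ arc D v u ≡ true
                      ⊎ ∃ λ w → arc D u w ≡ true × arc D v w ≡ true)

record Graph (m : ℕ) : Set where
  field
    adj   : Fin m → Fin m → Bool
    sym   : ∀ u v → adj u v ≡ adj v u
    irrefl : ∀ v → adj v v ≡ false
open Graph public

Adj : ∀ {m} → Graph m → Fin m → Fin m → Set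
Adj G u v = adj G u v ≡ true

degree : ∀ {m} → Graph m → Fin m → ℕ
degree {m} G v = length (filterᵇ (λ u → adj G v u) (allFin m))

IsoToPhylogeny : ∀ {m n} → Graph m → Digraph n → Set
IsoToPhylogeny {m} {n} G D =
  Σ (Fin m ↔ Fin n) λ f →
    ∀ u v → (Adj G u v → PAdj D (Inverse.to f u) (Inverse.to f v))
          × (PAdj D (Inverse.to f u) (Inverse.to f v) → Adj G u v)

IJPhylogenyGraph : ℕ → ℕ → ∀ {m} → Graph m → Set
IJPhylogenyGraph i j G = ∃ λ n → Σ (Digraph n) λ D → IJDigraph i j D × IsoToPhylogeny G D

TriangleFree : ∀ {m} → Graph m → Set
TriangleFree G = ∀ a b c → ¬ (Adj G a b × Adj G b c × Adj G a c)

-- a cycle: k+3 pairwise distinct vertices c₀,…,c_{k+2} with consecutive ones adjacent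
-- and c_{k+2} adjacent to c₀
HasCycle : ∀ {m} → Graph m → Set
HasCycle {m} G = ∃ λ k → Σ (Vec (Fin m) (suc (suc (suc k)))) λ c →
    Injective _≡_ _≡_ (lookup c)
  × (∀ (t : Fin (suc (suc k))) → Adj G (lookup c (Data.Fin.inject₁ t)) (lookup c (suc t)))
  × Adj G (lookup c (Data.Fin.fromℕ (suc (suc k)))) (lookup c zero)

Forest : ∀ {m} → Graph m → Set
Forest G = ¬ HasCycle G

-- Let G ≅ P(D) with D acyclic of outdegree ≤ j, and let G be triangle-free.
-- Two distinct in-neighbours a, b of a vertex x of D would span the triangle
-- a, b, x in P(D), so every vertex of D has at most one in-neighbour.  Hence two
-- vertices with a common out-neighbour coincide, and adjacency in G is just
-- being joined by an arc of D.  Both halves of the claim follow from this: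
--  * degree: the neighbours of v are its ≤ j out-neighbours and its ≤ 1
--    in-neighbour, counted through the bijection V(G) ≅ V(D);
--  * forest: a cycle of G is a closed walk along arcs of D that never turns
--    back.  Along it arc directions propagate (a forward arc followed by a
--    backward one gives a vertex two in-neighbours), so the walk is a directed
--    closed walk one way round or the other, contradicting acyclicity.
module Submission where

open import Defs hiding (sym)
open import Data.Nat using (ℕ; zero; suc; _+_; _≤_; _<_; z≤n; s≤s)
open import Data.Fin using (Fin; zero; suc; toℕ; fromℕ<; inject₁; fromℕ; _≟_)
open import Data.Product using (_×_; _,_; proj₁; proj₂)

open import Data.Nat.Properties
  using (≤-refl; ≤-trans; n≤1+n; ≤-reflexive; <⇒≤; +-mono-≤; m≤n⇒m<n∨m≡n; module ≤-Reasoning;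
         +-0-commutativeMonoid; +-commutativeSemigroup)
open import Data.Fin.Properties using (suc-injective; toℕ-fromℕ<; toℕ-inject₁; toℕ-fromℕ)
open import Data.Bool using (Bool; true; false; _∨_)
open import Data.Bool.Properties using (¬-not)
open import Data.List using (length; filterᵇ; allFin; tabulate)
open import Data.Vec using (Vec; lookup; _∷_; [])
open import Data.Sum using (_⊎_; inj₁; inj₂)
open import Data.Empty using (⊥; ⊥-elim)
open import Relation.Nullary using (¬_; yes; no)
open import Relation.Binary.PropositionalEquality
  using (_≡_; _≢_; refl; sym; trans; cong; subst; subst₂; ≢-sym; module ≡-Reasoning)
open import Function.Base using (_∘_; id)
open import Function.Bundles using (_↔_; Inverse; Injection)
open import Function.Definitions using (Injective)
open import Function.Properties.Inverse using (Inverse⇒Injection)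
open import Algebra.Properties.CommutativeMonoid.Sum +-0-commutativeMonoid
  using (sum; sum-permute)
open import Algebra.Properties.CommutativeSemigroup +-commutativeSemigroup
  using (interchange)

indicator : Bool → ℕ
indicator true  = 1
indicator false = 0

count : ∀ {n} → (Fin n → Bool) → ℕ
count p = sum (indicator ∘ p)

length-filter-tabulate : ∀ {A : Set} {n} (p : A → Bool) (f : Fin n → A) →
  length (filterᵇ p (tabulate f)) ≡ count (p ∘ f)
length-filter-tabulate {n = zero}  p f = refl
length-filter-tabulate {n = suc n} p f with p (f zero)
... | true  = cong suc (length-filter-tabulate p (f ∘ suc))
... | false = length-filter-tabulate p (f ∘ suc)

length-filter-allFin : ∀ {n} (p : Fin n → Bool) → length (filterᵇ p (allFin n)) ≡ count p
length-filter-allFin p = length-filter-tabulate p id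

sum-mono : ∀ {n} {f g : Fin n → ℕ} → (∀ x → f x ≤ g x) → sum f ≤ sum g
sum-mono {zero}  f≤g = z≤n
sum-mono {suc n} f≤g = +-mono-≤ (f≤g zero) (sum-mono (f≤g ∘ suc))

sum-+ : ∀ {n} (f g : Fin n → ℕ) → sum (λ x → f x + g x) ≡ sum f + sum g
sum-+ {zero}  f g = refl
sum-+ {suc n} f g =
  trans (cong (f zero + g zero +_) (sum-+ (f ∘ suc) (g ∘ suc)))
        (interchange (f zero) (g zero) (sum (f ∘ suc)) (sum (g ∘ suc)))

count-mono : ∀ {n} (p q : Fin n → Bool) → (∀ x → p x ≡ true → q x ≡ true) →
  count p ≤ count q
count-mono p q p⇒q = sum-mono indicator-mono
  where
  indicator-mono : ∀ x → indicator (p x) ≤ indicator (q x)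
  indicator-mono x with p x | q x | p⇒q x
  ... | false | _     | _   = z≤n
  ... | true  | true  | _   = ≤-refl
  ... | true  | false | imp with () ← imp refl

count-∨ : ∀ {n} (p q : Fin n → Bool) → count (λ x → p x ∨ q x) ≤ count p + count q
count-∨ p q = ≤-trans (sum-mono indicator-∨) (≤-reflexive (sum-+ (indicator ∘ p) (indicator ∘ q)))
  where
  indicator-∨ : ∀ x → indicator (p x ∨ q x) ≤ indicator (p x) + indicator (q x)
  indicator-∨ x with p x | q x
  ... | true  | _     = s≤s z≤n
  ... | false | true  = ≤-refl
  ... | false | false = z≤n

count-none : ∀ {n} (p : Fin n → Bool) → (∀ x → p x ≡ false) → count p ≡ 0
count-none {zero}  p never = refl
count-none {suc n} p never rewrite never zero = count-none (p ∘ suc) (never ∘ suc)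

count-atMostOne : ∀ {n} (p : Fin n → Bool) → (∀ x y → p x ≡ true → p y ≡ true → x ≡ y) →
  count p ≤ 1
count-atMostOne {zero}  p unique = z≤n
count-atMostOne {suc n} p unique with p zero in p0
... | false = count-atMostOne (p ∘ suc) (λ x y px py → suc-injective (unique _ _ px py))
... | true  = s≤s (≤-reflexive (count-none (p ∘ suc) (λ x → ¬-not (λ px → 0≢suc (unique _ _ p0 px)))))
  where
  0≢suc : ∀ {x : Fin n} → zero ≢ suc x
  0≢suc ()

count-permute : ∀ {m n} (f : Fin m ↔ Fin n) (p : Fin n → Bool) →
  count p ≡ count (p ∘ Inverse.to f)
count-permute f p = sum-permute (indicator ∘ p) f

-- A closed walk  walk 0, walk 1, …, walk (suc len) = walk 0  whose consecutive
-- vertices are R-related and which never returns to the vertex it has just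
-- left, not even across the closing point.
record NonBacktrackingClosedWalk {A : Set} (R : A → A → Set) : Set where
  field
    len             : ℕ
    walk            : ℕ → A
    steps           : ∀ t → t ≤ len → R (walk t) (walk (suc t))
    closed          : walk (suc len) ≡ walk 0
    noReturn        : ∀ t → suc t ≤ len → walk t ≢ walk (suc (suc t))
    noReturnAtClose : walk len ≢ walk 1

map-walk : ∀ {A B : Set} {R : A → A → Set} {S : B → B → Set} (g : A → B) →
  Injective _≡_ _≡_ g → (∀ {x y} → R x y → S (g x) (g y)) →
  NonBacktrackingClosedWalk R → NonBacktrackingClosedWalk S
map-walk g g-injective g-hom W = record
  { len             = len
  ; walk            = g ∘ walk
  ; steps           = λ t t≤len → g-hom (steps t t≤len)
  ; closed          = cong g closed
  ; noReturn        = λ t t<len → noReturn t t<len ∘ g-injective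
  ; noReturnAtClose = noReturnAtClose ∘ g-injective
  }
  where open NonBacktrackingClosedWalk W

lookupOr : ∀ {A : Set} {N} → Vec A N → A → ℕ → A
lookupOr []       a t       = a
lookupOr (y ∷ ys) a zero    = y
lookupOr (y ∷ ys) a (suc t) = lookupOr ys a t

lookupOr-toℕ : ∀ {A : Set} {N} (v : Vec A N) a (i : Fin N) → lookupOr v a (toℕ i) ≡ lookup v i
lookupOr-toℕ (y ∷ ys) a zero    = refl
lookupOr-toℕ (y ∷ ys) a (suc i) = lookupOr-toℕ ys a i

lookupOr-length : ∀ {A : Set} {N} (v : Vec A N) a → lookupOr v a N ≡ a
lookupOr-length []       a = refl
lookupOr-length (y ∷ ys) a = lookupOr-length ys a

-- Reading a cycle c₀ … c_{k+2} of G cyclically (c_{k+3} = c₀) gives a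
-- non-backtracking closed walk: its k+3 vertices are distinct and k+3 ≥ 3.
cycle⇒walk : ∀ {m} (G : Graph m) → HasCycle G → NonBacktrackingClosedWalk (Adj G)
cycle⇒walk {m} G (k , c@(c₀ ∷ cs) , c-injective , consecutive , closing) = record
  { len             = suc (suc k)
  ; walk            = walk
  ; steps           = steps
  ; closed          = lookupOr-length cs c₀
  ; noReturn        = noReturn
  ; noReturnAtClose = noReturnAtClose
  }
  where
  walk : ℕ → Fin m
  walk = lookupOr c c₀

  walk-at : ∀ (i : Fin (suc (suc (suc k)))) → walk (toℕ i) ≡ lookup c i
  walk-at = lookupOr-toℕ c c₀

  walk-at-fromℕ< : ∀ {t} (t< : t < suc (suc (suc k))) → walk t ≡ lookup c (fromℕ< t<)
  walk-at-fromℕ< t< = trans (cong walk (sym (toℕ-fromℕ< t<))) (walk-at (fromℕ< t<))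

  walk-injective : ∀ {t s} → t < suc (suc (suc k)) → s < suc (suc (suc k)) →
    walk t ≡ walk s → t ≡ s
  walk-injective {t} {s} t< s< e = begin
    t                   ≡⟨ sym (toℕ-fromℕ< t<) ⟩
    toℕ (fromℕ< t<)     ≡⟨ cong toℕ (c-injective lookups) ⟩
    toℕ (fromℕ< s<)     ≡⟨ toℕ-fromℕ< s< ⟩
    s                   ∎
    where
    open ≡-Reasoning
    lookups : lookup c (fromℕ< t<) ≡ lookup c (fromℕ< s<)
    lookups = trans (sym (walk-at-fromℕ< t<)) (trans e (walk-at-fromℕ< s<))

  steps : ∀ t → t ≤ suc (suc k) → Adj G (walk t) (walk (suc t))
  steps t t≤ with m≤n⇒m<n∨m≡n t≤
  ... | inj₁ t< = subst₂ (Adj G) here next (consecutive i)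
    where
    i = fromℕ< t<
    here : lookup c (inject₁ i) ≡ walk t
    here = trans (sym (walk-at (inject₁ i))) (cong walk (trans (toℕ-inject₁ i) (toℕ-fromℕ< t<)))
    next : lookup c (suc i) ≡ walk (suc t)
    next = trans (sym (walk-at (suc i))) (cong (walk ∘ suc) (toℕ-fromℕ< t<))
  ... | inj₂ refl = subst₂ (Adj G) last (sym (lookupOr-length cs c₀)) closing
    where
    last : lookup c (fromℕ (suc (suc k))) ≡ walk (suc (suc k))
    last = trans (sym (walk-at (fromℕ (suc (suc k))))) (cong walk (toℕ-fromℕ (suc (suc k))))

  -- positions t and t+2 differ: both lie in the vector, or t+2 is the closing
  -- position c₀ and t = k+1 ≠ 0
  noReturn : ∀ t → suc t ≤ suc (suc k) → walk t ≢ walk (suc (suc t))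
  noReturn t t< e with m≤n⇒m<n∨m≡n t<
  ... | inj₁ t+1< with () ← walk-injective (≤-trans t< (n≤1+n _)) (s≤s t+1<) e
  ... | inj₂ refl with () ← walk-injective (n≤1+n _) (s≤s z≤n)
                               (trans e (lookupOr-length cs c₀))

  noReturnAtClose : walk (suc (suc k)) ≢ walk 1
  noReturnAtClose e with () ← walk-injective ≤-refl (s≤s (s≤s z≤n)) e

Linked : ∀ {n} → Digraph n → Fin n → Fin n → Set
Linked D a b = arc D a b ≡ true ⊎ arc D b a ≡ true

UniqueInNeighbours : ∀ {n} → Digraph n → Set
UniqueInNeighbours D = ∀ {a b x} → arc D a x ≡ true → arc D b x ≡ true → a ≡ b

arc⇒≢ : ∀ {n} (D : Digraph n) {a b} → arc D a b ≡ true → a ≢ b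
arc⇒≢ D {a} a→b refl with () ← trans (sym a→b) (loopless D a)

_∷ʳ_ : ∀ {n} {D : Digraph n} {a b c} → Reach⁺ D a b → arc D b c ≡ true → Reach⁺ D a c
step a→b   ∷ʳ b→c = a→b ∷ step b→c
(a→x ∷ r)  ∷ʳ b→c = a→x ∷ (r ∷ʳ b→c)

-- Along a non-backtracking closed walk the arc directions propagate, so the walk
-- is a directed closed walk one way round or the other.
noNonBacktrackingClosedWalk : ∀ {n} {D : Digraph n} → Acyclic D → UniqueInNeighbours D →
  ¬ NonBacktrackingClosedWalk (Linked D)
noNonBacktrackingClosedWalk {D = D} acyclic unique W = directedCycle
  where
  open NonBacktrackingClosedWalk W

  _⇒_ : ℕ → ℕ → Set
  s ⇒ t = arc D (walk s) (walk t) ≡ true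

  -- a forward arc is followed by a forward arc, else walk (t+1) has the two
  -- in-neighbours walk t ≠ walk (t+2)
  keepsForward : ∀ t → suc t ≤ len → t ⇒ suc t → suc t ⇒ suc (suc t)
  keepsForward t t< forward with steps (suc t) t<
  ... | inj₁ forward′ = forward′
  ... | inj₂ backward = ⊥-elim (noReturn t t< (unique forward backward))

  keepsBackward : ∀ t → suc t ≤ len → suc (suc t) ⇒ suc t → suc t ⇒ t
  keepsBackward t t< backward with steps t (<⇒≤ t<)
  ... | inj₁ forward   = ⊥-elim (noReturn t t< (unique forward backward))
  ... | inj₂ backward′ = backward′

  forwardPath : 0 ⇒ 1 → ∀ s → s ≤ len → s ⇒ suc s × Reach⁺ D (walk 0) (walk (suc s))
  forwardPath first zero    _  = first , step first
  forwardPath first (suc s) s< with forwardPath first s (<⇒≤ s<)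
  ... | arcₛ , path = keepsForward s s< arcₛ , path ∷ʳ keepsForward s s< arcₛ

  backwardPath : ∀ s → s ≤ len → suc s ⇒ s → Reach⁺ D (walk (suc s)) (walk 0)
  backwardPath zero    _  back = step back
  backwardPath (suc s) s< back = back ∷ backwardPath s (<⇒≤ s<) (keepsBackward s s< back)

  directedCycle : ⊥
  directedCycle with steps 0 z≤n
  ... | inj₁ first = acyclic (walk 0)
        (subst (Reach⁺ D (walk 0)) closed (proj₂ (forwardPath first len ≤-refl)))
  ... | inj₂ first with steps len ≤-refl
  ...   | inj₂ last = acyclic (walk 0)
          (subst (λ v → Reach⁺ D v (walk 0)) closed (backwardPath len ≤-refl last))
  -- the walk enters walk 0 both from walk 1 and from walk len
  ...   | inj₁ last = noReturnAtClose
          (unique (subst (λ v → arc D (walk len) v ≡ true) closed last) first)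

-- Boolean version of Linked, with the in-arc first so that counting it gives
-- the bound 1 + outdegree directly
linked? : ∀ {n} → Digraph n → Fin n → Fin n → Bool
linked? D a b = arc D b a ∨ arc D a b

Linked⇒linked? : ∀ {n} (D : Digraph n) {a b} → Linked D a b → linked? D a b ≡ true
Linked⇒linked? D {a} {b} (inj₁ a→b) with arc D b a
... | true  = refl
... | false = a→b
Linked⇒linked? D (inj₂ b→a) rewrite b→a = refl

-- a vertex is linked to its out-neighbours and its unique in-neighbour
count-linked : ∀ {n} (D : Digraph n) → UniqueInNeighbours D → ∀ a →
  count (linked? D a) ≤ suc (outdeg D a)
count-linked D unique a = ≤-trans (count-∨ (λ x → arc D x a) (arc D a))
  (+-mono-≤ (count-atMostOne (λ x → arc D x a) (λ x y → unique))
            (≤-reflexive (sym (length-filter-allFin (arc D a)))))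

module TriangleFreePhylogeny {m n} {G : Graph m} {D : Digraph n}
  (G≅PD : IsoToPhylogeny G D) (triangleFree : TriangleFree G) where

  f : Fin m ↔ Fin n
  f = proj₁ G≅PD

  to : Fin m → Fin n
  to = Inverse.to f

  from : Fin n → Fin m
  from = Inverse.from f

  to-injective : Injective _≡_ _≡_ to
  to-injective = Injection.injective (Inverse⇒Injection f)

  fromPAdj : ∀ {a b} → PAdj D a b → Adj G (from a) (from b)
  fromPAdj {a} {b} a~b = proj₂ (proj₂ G≅PD (from a) (from b))
    (subst₂ (PAdj D) (sym (Inverse.strictlyInverseˡ f a)) (sym (Inverse.strictlyInverseˡ f b)) a~b)

  -- two distinct in-neighbours a, b of x would form the triangle a, x, b
  uniqueInNeighbours : UniqueInNeighbours D
  uniqueInNeighbours {a} {b} {x} a→x b→x with a ≟ b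
  ... | yes a≡b = a≡b
  ... | no  a≢b = ⊥-elim (triangleFree (from a) (from x) (from b)
          ( fromPAdj (arc⇒≢ D a→x , inj₁ a→x)
          , fromPAdj (≢-sym (arc⇒≢ D b→x) , inj₂ (inj₁ b→x))
          , fromPAdj (a≢b , inj₂ (inj₂ (x , a→x , b→x)))))

  -- so G-adjacent vertices are joined by an arc: a common out-neighbour would
  -- force them to coincide
  adj⇒linked : ∀ {u v} → Adj G u v → Linked D (to u) (to v)
  adj⇒linked {u} {v} u~v with proj₁ (proj₂ G≅PD u v) u~v
  ... | _   , inj₁ u→v                     = inj₁ u→v
  ... | _   , inj₂ (inj₁ v→u)              = inj₂ v→u
  ... | u≢v , inj₂ (inj₂ (_ , u→x , v→x)) = ⊥-elim (u≢v (uniqueInNeighbours u→x v→x))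

  degree≤count-linked : ∀ v → degree G v ≤ count (linked? D (to v))
  degree≤count-linked v = begin
    degree G v                       ≡⟨ length-filter-allFin (adj G v) ⟩
    count (adj G v)                  ≤⟨ count-mono (adj G v) (linked? D (to v) ∘ to)
                                          (λ u → Linked⇒linked? D ∘ adj⇒linked) ⟩
    count (linked? D (to v) ∘ to)    ≡⟨ sym (count-permute f (linked? D (to v))) ⟩
    count (linked? D (to v))         ∎
    where open ≤-Reasoning

corollary2p2 : (i j : ℕ) → 1 ≤ i → 1 ≤ j → ∀ {m} (G : Graph m) →
    IJPhylogenyGraph i j G → TriangleFree G →
    Forest G × (∀ (v : Fin m) → degree G v ≤ suc j)
corollary2p2 i j _ _ G (n , D , (acyclic , _ , outdeg≤j) , G≅PD) triangleFree =
  forest , maxDegree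
  where
  open TriangleFreePhylogeny {G = G} {D = D} G≅PD triangleFree

  forest : Forest G
  forest cycle = noNonBacktrackingClosedWalk acyclic uniqueInNeighbours
    (map-walk to to-injective adj⇒linked (cycle⇒walk G cycle))

  maxDegree : ∀ v → degree G v ≤ suc j
  maxDegree v = begin
    degree G v                ≤⟨ degree≤count-linked v ⟩
    count (linked? D (to v))  ≤⟨ count-linked D uniqueInNeighbours (to v) ⟩
    suc (outdeg D (to v))     ≤⟨ s≤s (outdeg≤j (to v)) ⟩
    suc j                     ∎
    where open ≤-Reasoning
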